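{- For nonnegative integers $m,n$, the following identity holds as an identity of rational functions in an indeterminate $x$: \[ \sum_{a=1}^{m}\sum_{b=1}^{n}\frac{(mx+nx+1)_{a+b-2}}{(mx+1)_{a-1}(nx+1)_{b-1}}\binom{m+n-a-b}{m-a} =\frac{mn\,(mx+nx+1)_{m+n}}{(m+n)(mx+1)_{m}(nx+1)_{n}}-\frac{mnx}{(m+n)(1+x)}\binom{m+n}{m}. \]
   Context: $(z)_k=z(z+1)\cdots(z+k-1)$ denotes the rising factorial (Pochhammer symbol), with $(z)_0=1$. Binomial coefficients with negative lower index are $0$. -}

module Defs where

open import Data.Nat as ℕ using (ℕ; zero; suc)
open import Data.Nat.Combinatorics using (_C_)
open import Data.Rational as ℚ using (ℚ; 0ℚ; 1ℚ; _+_; _*_; _-_; _÷_; ≢-nonZero)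
open import Data.Rational.Properties using (_≟_)
open import Relation.Nullary using (yes; no)

ι : ℕ → ℚ
ι n = ℚ.fromℚᵘ (Data.Rational.Unnormalised.mkℚᵘ (Data.Integer.+ n) 0)
  where import Data.Rational.Unnormalised ; import Data.Integer

poch : ℚ → ℕ → ℚ
poch z zero    = 1ℚ
poch z (suc k) = poch z k * (z + ι k)

-- total division on ℚ (p / 0 := 0); only used where the denominator is nonzero
_/ₜ_ : ℚ → ℚ → ℚ
p /ₜ q with q ≟ 0ℚ
... | yes _  = 0ℚ
... | no q≢0 = _÷_ p q {{≢-nonZero q≢0}}

infixl 7 _/ₜ_

Σ₁ : ℕ → (ℕ → ℚ) → ℚ
Σ₁ zero    f = 0ℚ
Σ₁ (suc m) f = Σ₁ m f + f (suc m)

-- With p = mx + 1, q = nx + 1 and r = p + q - 1, the summand is t(a-1, b-1) for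
-- t(i, j) = (r)_{i+j} / ((p)_i (q)_j), and the binomial coefficient counts the lattice
-- paths from (a, b) to (m, n).  Because r + i + j + 1 = (p + i) + (q + j), t obeys
-- Pascal's rule t(i+1, j+1) = t(i, j+1) + t(i+1, j).  The path-weighted sum G(M, N)
-- obeys G(M+1, N+1) = G(M, N+1) + G(M+1, N) + t(M, N), and by Pascal's rule so does
-- N t(M-1, N); the two differ only on the first row, by b (t(0, b-1) - t(0, b)), and
-- this defect is carried to (m, n) along lattice paths.  Against
-- W(k) = t(0, k) C(m+n-k-1, m) the resulting boundary sum telescopes (via the
-- absorption identities for binomials) to -mx/(1+x) C(m+n-1, m), which is the second
-- term on the right; n t(m-1, n) is the first.
module Submission where

open import Defs
open import Data.Nat as ℕ using (ℕ; zero; suc; _≤_; _∸_)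
import Data.Nat.Properties as ℕₚ
import Data.Nat.Tactic.RingSolver as ℕ-Solver
open import Data.Nat.Combinatorics using (_C_; nCn≡1; nCk+nC[k+1]≡[n+1]C[k+1])
open import Data.Integer as ℤ using (1ℤ)
open import Data.Integer.Properties using (pos-+)
import Data.Integer.Tactic.RingSolver as ℤ-Solver
open import Data.Rational using (ℚ; 0ℚ; 1ℚ; _+_; _*_; _-_; -_; 1/_; toℚᵘ; ≢-nonZero)
open import Data.Rational.Properties
  using (_≟_; +-*-commutativeRing; toℚᵘ-injective; toℚᵘ-fromℚᵘ; toℚᵘ-homo-+;
         +-identityˡ; +-identityʳ; +-inverseʳ; +-comm; *-identityˡ; *-identityʳ; *-zeroˡ; *-zeroʳ; *-assoc;
         *-distribˡ-+; *-distribʳ-+; *-inverseˡ; *-inverseʳ; neg-distribˡ-*)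
import Data.Rational.Unnormalised as ℚᵘ
import Data.Rational.Unnormalised.Properties as ℚᵘ
open import Data.List using (_∷_; [])
open import Level using (0ℓ)
open import Relation.Nullary.Decidable using (yes; no; dec⇒maybe)
open import Relation.Nullary.Negation using (contradiction)
open import Relation.Binary.PropositionalEquality
open import Tactic.RingSolver using (solve-∀; solve)
open import Tactic.RingSolver.Core.AlmostCommutativeRing using (AlmostCommutativeRing; fromCommutativeRing)

ℚ-ring : AlmostCommutativeRing 0ℓ 0ℓ
ℚ-ring = fromCommutativeRing +-*-commutativeRing (λ p → dec⇒maybe (0ℚ ≟ p))

ι-+ : ∀ a b → ι (a ℕ.+ b) ≡ ι a + ι b
ι-+ a b = toℚᵘ-injective (begin
  toℚᵘ (ι (a ℕ.+ b))                         ≈⟨ toℚᵘ-fromℚᵘ (ℚᵘ.mkℚᵘ (ℤ.+ (a ℕ.+ b)) 0) ⟩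
  ℚᵘ.mkℚᵘ (ℤ.+ (a ℕ.+ b)) 0                  ≈⟨ ℚᵘ.*≡* (trans (cong (ℤ._* 1ℤ) (pos-+ a b)) (cross (ℤ.+ a) (ℤ.+ b))) ⟩
  ℚᵘ.mkℚᵘ (ℤ.+ a) 0 ℚᵘ.+ ℚᵘ.mkℚᵘ (ℤ.+ b) 0   ≈⟨ ℚᵘ.+-cong (ℚᵘ.≃-sym (toℚᵘ-fromℚᵘ (ℚᵘ.mkℚᵘ (ℤ.+ a) 0)))
                                                           (ℚᵘ.≃-sym (toℚᵘ-fromℚᵘ (ℚᵘ.mkℚᵘ (ℤ.+ b) 0))) ⟩
  toℚᵘ (ι a) ℚᵘ.+ toℚᵘ (ι b)                 ≈⟨ ℚᵘ.≃-sym (toℚᵘ-homo-+ (ι a) (ι b)) ⟩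
  toℚᵘ (ι a + ι b)                           ∎)
  where
  open ℚᵘ.≃-Reasoning
  cross : ∀ x y → (x ℤ.+ y) ℤ.* 1ℤ ≡ (x ℤ.* 1ℤ ℤ.+ y ℤ.* 1ℤ) ℤ.* 1ℤ
  cross = ℤ-Solver.solve-∀

open ≡-Reasoning

ι-suc : ∀ n → ι (suc n) ≡ 1ℚ + ι n
ι-suc = ι-+ 1

ι-* : ∀ a b → ι (a ℕ.* b) ≡ ι a * ι b
ι-* zero    b = sym (*-zeroˡ (ι b))
ι-* (suc a) b = begin
  ι (b ℕ.+ a ℕ.* b)      ≡⟨ trans (ι-+ b (a ℕ.* b)) (cong (ι b +_) (ι-* a b)) ⟩
  ι b + ι a * ι b        ≡⟨ cong (_+ ι a * ι b) (sym (*-identityˡ (ι b))) ⟩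
  1ℚ * ι b + ι a * ι b   ≡⟨ sym (*-distribʳ-+ (ι b) 1ℚ (ι a)) ⟩
  (1ℚ + ι a) * ι b       ≡⟨ cong (_* ι b) (sym (ι-suc a)) ⟩
  ι (suc a) * ι b        ∎

p*q≢0 : ∀ {p q} → p ≢ 0ℚ → q ≢ 0ℚ → p * q ≢ 0ℚ
p*q≢0 {p} {q} p≢0 q≢0 pq≡0 = q≢0 (begin
  q                  ≡⟨ sym (*-identityˡ q) ⟩
  1ℚ * q             ≡⟨ cong (_* q) (sym (*-inverseˡ p)) ⟩
  1/ p * p * q       ≡⟨ *-assoc (1/ p) p q ⟩
  1/ p * (p * q)     ≡⟨ cong (1/ p *_) pq≡0 ⟩
  1/ p * 0ℚ          ≡⟨ *-zeroʳ (1/ p) ⟩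
  0ℚ                 ∎)
  where instance _ = ≢-nonZero p≢0

p*q≢0⇒p≢0 : ∀ {p q} → p * q ≢ 0ℚ → p ≢ 0ℚ
p*q≢0⇒p≢0 {q = q} pq≢0 refl = pq≢0 (*-zeroˡ q)

*-cancelʳ-≡ : ∀ {p q r} → r ≢ 0ℚ → p * r ≡ q * r → p ≡ q
*-cancelʳ-≡ {p} {q} {r} r≢0 pr≡qr = begin
  p                ≡⟨ sym (*-identityʳ p) ⟩
  p * 1ℚ           ≡⟨ cong (p *_) (sym (*-inverseʳ r)) ⟩
  p * (r * 1/ r)   ≡⟨ sym (*-assoc p r (1/ r)) ⟩
  p * r * 1/ r     ≡⟨ cong (_* 1/ r) pr≡qr ⟩
  q * r * 1/ r     ≡⟨ *-assoc q r (1/ r) ⟩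
  q * (r * 1/ r)   ≡⟨ cong (q *_) (*-inverseʳ r) ⟩
  q * 1ℚ           ≡⟨ *-identityʳ q ⟩
  q                ∎
  where instance _ = ≢-nonZero r≢0

p/q*q≡p : ∀ p {q} → q ≢ 0ℚ → p /ₜ q * q ≡ p
p/q*q≡p p {q} q≢0 with q ≟ 0ℚ
... | yes q≡0 = contradiction q≡0 q≢0
... | no  _   = begin
  p * 1/ q * q     ≡⟨ *-assoc p (1/ q) q ⟩
  p * (1/ q * q)   ≡⟨ cong (p *_) (*-inverseˡ q) ⟩
  p * 1ℚ           ≡⟨ *-identityʳ p ⟩
  p                ∎
  where instance _ = ≢-nonZero q≢0

p≡z*q⇒p/q≡z : ∀ {p q z} → q ≢ 0ℚ → p ≡ z * q → p /ₜ q ≡ z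
p≡z*q⇒p/q≡z {p} q≢0 p≡zq = *-cancelʳ-≡ q≢0 (trans (p/q*q≡p p q≢0) p≡zq)

0/q≡0 : ∀ q → 0ℚ /ₜ q ≡ 0ℚ
0/q≡0 q with q ≟ 0ℚ
... | yes _   = refl
... | no  q≢0 = *-zeroˡ (1/ q)
  where instance _ = ≢-nonZero q≢0

poch-≢0-≤ : ∀ z {k} N → k ≤ N → poch z N ≢ 0ℚ → poch z k ≢ 0ℚ
poch-≢0-≤ z zero    ℕ.z≤n  poch≢0 = poch≢0
poch-≢0-≤ z {k} (suc N) k≤1+N poch≢0 with k ℕ.≤? N
... | yes k≤N = poch-≢0-≤ z N k≤N (p*q≢0⇒p≢0 poch≢0)
... | no  k≰N = subst (λ i → poch z i ≢ 0ℚ) (ℕₚ.≤-antisym (ℕₚ.≰⇒> k≰N) k≤1+N) poch≢0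

Σ₁-cong : ∀ M {f g : ℕ → ℚ} → (∀ a → suc a ≤ M → f (suc a) ≡ g (suc a)) → Σ₁ M f ≡ Σ₁ M g
Σ₁-cong zero    f≗g = refl
Σ₁-cong (suc M) f≗g = cong₂ _+_ (Σ₁-cong M (λ a a<M → f≗g a (ℕₚ.m≤n⇒m≤1+n a<M))) (f≗g M ℕₚ.≤-refl)

Σ₁-0 : ∀ M → Σ₁ M (λ _ → 0ℚ) ≡ 0ℚ
Σ₁-0 zero    = refl
Σ₁-0 (suc M) = cong (_+ 0ℚ) (Σ₁-0 M)

Σ₁-+ : ∀ M (f g : ℕ → ℚ) → Σ₁ M (λ a → f a + g a) ≡ Σ₁ M f + Σ₁ M g
Σ₁-+ zero    f g = sym (+-identityˡ 0ℚ)
Σ₁-+ (suc M) f g = begin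
  Σ₁ M (λ a → f a + g a) + (f (suc M) + g (suc M))  ≡⟨ cong (_+ (f (suc M) + g (suc M))) (Σ₁-+ M f g) ⟩
  Σ₁ M f + Σ₁ M g + (f (suc M) + g (suc M))         ≡⟨ interchange (Σ₁ M f) (Σ₁ M g) (f (suc M)) (g (suc M)) ⟩
  Σ₁ M f + f (suc M) + (Σ₁ M g + g (suc M))         ∎
  where
  interchange : ∀ a b c d → a + b + (c + d) ≡ a + c + (b + d)
  interchange = solve-∀ ℚ-ring

Σ₁-*ʳ : ∀ M (f : ℕ → ℚ) c → Σ₁ M f * c ≡ Σ₁ M (λ a → f a * c)
Σ₁-*ʳ zero    f c = *-zeroˡ c
Σ₁-*ʳ (suc M) f c = trans (*-distribʳ-+ c (Σ₁ M f) (f (suc M))) (cong (_+ f (suc M) * c) (Σ₁-*ʳ M f c))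

Σ₁-telescope : ∀ M (g : ℕ → ℚ) → Σ₁ M (λ a → g a - g (a ∸ 1)) ≡ g M - g 0
Σ₁-telescope zero    g = sym (+-inverseʳ (g 0))
Σ₁-telescope (suc M) g = begin
  Σ₁ M (λ a → g a - g (a ∸ 1)) + (g (suc M) - g M)  ≡⟨ cong (_+ (g (suc M) - g M)) (Σ₁-telescope M g) ⟩
  g M - g 0 + (g (suc M) - g M)                     ≡⟨ cancel (g 0) (g M) (g (suc M)) ⟩
  g (suc M) - g 0                                   ∎
  where
  cancel : ∀ a b c → b - a + (c - b) ≡ c - a
  cancel = solve-∀ ℚ-ring

Σ₁-first : ∀ M (f : ℕ → ℚ) → (∀ a → f (suc (suc a)) ≡ 0ℚ) → Σ₁ (suc M) f ≡ f 1
Σ₁-first zero    f f≡0 = +-identityˡ (f 1)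
Σ₁-first (suc M) f f≡0 = trans (cong₂ _+_ (Σ₁-first M f f≡0) (f≡0 M)) (+-identityʳ (f 1))

paths : ℕ → ℕ → ℕ
paths zero    e       = 1
paths (suc d) zero    = 1
paths (suc d) (suc e) = paths d (suc e) ℕ.+ paths (suc d) e

paths-zeroʳ : ∀ d → paths d 0 ≡ 1
paths-zeroʳ zero    = refl
paths-zeroʳ (suc d) = refl

C≡paths : ∀ d e → (d ℕ.+ e) C d ≡ paths d e
C≡paths zero    e       = refl
C≡paths (suc d) zero    = trans (cong (_C suc d) (ℕₚ.+-identityʳ (suc d))) (nCn≡1 (suc d))
C≡paths (suc d) (suc e) = begin
  suc (d ℕ.+ suc e) C suc d                      ≡⟨ sym (nCk+nC[k+1]≡[n+1]C[k+1] (d ℕ.+ suc e) d) ⟩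
  (d ℕ.+ suc e) C d ℕ.+ (d ℕ.+ suc e) C suc d    ≡⟨ cong₂ ℕ._+_ (C≡paths d (suc e))
                                                       (trans (cong (_C suc d) (ℕₚ.+-suc d e)) (C≡paths (suc d) e)) ⟩
  paths d (suc e) ℕ.+ paths (suc d) e            ∎

paths-absorbˡ : ∀ d e → suc d ℕ.* paths (suc d) e ≡ suc (d ℕ.+ e) ℕ.* paths d e
paths-absorbʳ : ∀ d e → suc e ℕ.* paths d (suc e) ≡ suc (d ℕ.+ e) ℕ.* paths d e

paths-absorbˡ d zero    = cong₂ (λ k l → suc k ℕ.* l) (sym (ℕₚ.+-identityʳ d)) (sym (paths-zeroʳ d))
paths-absorbˡ d (suc e) = begin
  suc d ℕ.* (X ℕ.+ Y)              ≡⟨ ℕₚ.*-distribˡ-+ (suc d) X Y ⟩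
  suc d ℕ.* X ℕ.+ suc d ℕ.* Y      ≡⟨ cong (suc d ℕ.* X ℕ.+_) (trans (paths-absorbˡ d e) (sym (paths-absorbʳ d e))) ⟩
  suc d ℕ.* X ℕ.+ suc e ℕ.* X      ≡⟨ collect d e X ⟩
  suc (d ℕ.+ suc e) ℕ.* X          ∎
  where
  X = paths d (suc e)
  Y = paths (suc d) e
  collect : ∀ d e X → suc d ℕ.* X ℕ.+ suc e ℕ.* X ≡ suc (d ℕ.+ suc e) ℕ.* X
  collect = ℕ-Solver.solve-∀

paths-absorbʳ zero    e = refl
paths-absorbʳ (suc d) e = begin
  suc e ℕ.* (X ℕ.+ Y)              ≡⟨ ℕₚ.*-distribˡ-+ (suc e) X Y ⟩
  suc e ℕ.* X ℕ.+ suc e ℕ.* Y      ≡⟨ cong (ℕ._+ suc e ℕ.* Y) (trans (paths-absorbʳ d e) (sym (paths-absorbˡ d e))) ⟩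
  suc d ℕ.* Y ℕ.+ suc e ℕ.* Y      ≡⟨ collect d e Y ⟩
  suc (suc d ℕ.+ e) ℕ.* Y          ∎
  where
  X = paths d (suc e)
  Y = paths (suc d) e
  collect : ∀ d e Y → suc d ℕ.* Y ℕ.+ suc e ℕ.* Y ≡ suc (suc d ℕ.+ e) ℕ.* Y
  collect = ℕ-Solver.solve-∀

C≡paths-∸ : ∀ {M N a b} → a ≤ M → b ≤ N → (M ℕ.+ N ∸ a ∸ b) C (M ∸ a) ≡ paths (M ∸ a) (N ∸ b)
C≡paths-∸ {M} {N} {a} {b} a≤M b≤N = begin
  (M ℕ.+ N ∸ a ∸ b) C (M ∸ a)      ≡⟨ cong (λ k → (k ∸ b) C (M ∸ a)) (ℕₚ.+-∸-comm N a≤M) ⟩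
  (M ∸ a ℕ.+ N ∸ b) C (M ∸ a)      ≡⟨ cong (_C (M ∸ a)) (ℕₚ.+-∸-assoc (M ∸ a) b≤N) ⟩
  (M ∸ a ℕ.+ (N ∸ b)) C (M ∸ a)    ≡⟨ C≡paths (M ∸ a) (N ∸ b) ⟩
  paths (M ∸ a) (N ∸ b)            ∎

paths-pascal-∸ : ∀ {M N a b} → a ≤ M → b ≤ N →
  paths (suc M ∸ a) (suc N ∸ b) ≡ paths (M ∸ a) (suc N ∸ b) ℕ.+ paths (suc M ∸ a) (N ∸ b)
paths-pascal-∸ a≤M b≤N rewrite ℕₚ.+-∸-assoc 1 a≤M | ℕₚ.+-∸-assoc 1 b≤N = refl

paths-∸-self : ∀ d N → paths d (N ∸ N) ≡ 1
paths-∸-self d N rewrite ℕₚ.n∸n≡0 N = paths-zeroʳ d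

row : (ℕ → ℕ → ℚ) → ℕ → ℕ → ℕ → ℚ
row c M N a = Σ₁ N λ b → c a b * ι (paths (M ∸ a) (N ∸ b))

conv : (ℕ → ℕ → ℚ) → ℕ → ℕ → ℚ
conv c M N = Σ₁ M (row c M N)

conv-zeroʳ : ∀ c M → conv c M 0 ≡ 0ℚ
conv-zeroʳ c = Σ₁-0

row-suc-suc : ∀ c {M N a} → a ≤ M → row c (suc M) (suc N) a ≡ row c M (suc N) a + row c (suc M) N a
row-suc-suc c {M} {N} {a} a≤M = begin
  Σ₁ N (λ b → c a b * ι (paths (suc M ∸ a) (suc N ∸ b))) + c a (suc N) * ι (paths (suc M ∸ a) (N ∸ N))
    ≡⟨ cong₂ _+_ (Σ₁-cong N split) (cong (λ k → c a (suc N) * ι k)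
                                          (trans (paths-∸-self (suc M ∸ a) N) (sym (paths-∸-self (M ∸ a) N)))) ⟩
  Σ₁ N (λ b → f b + g b) + z    ≡⟨ cong (_+ z) (Σ₁-+ N f g) ⟩
  Σ₁ N f + Σ₁ N g + z           ≡⟨ swap (Σ₁ N f) (Σ₁ N g) z ⟩
  Σ₁ N f + z + Σ₁ N g           ∎
  where
  f g : ℕ → ℚ
  f b = c a b * ι (paths (M ∸ a) (suc N ∸ b))
  g b = c a b * ι (paths (suc M ∸ a) (N ∸ b))
  z = c a (suc N) * ι (paths (M ∸ a) (N ∸ N))
  split : ∀ b → suc b ≤ N → c a (suc b) * ι (paths (suc M ∸ a) (suc N ∸ suc b)) ≡ f (suc b) + g (suc b)
  split b b<N = begin
    c a (suc b) * ι (paths (suc M ∸ a) (suc N ∸ suc b))  ≡⟨ cong (λ k → c a (suc b) * ι k) (paths-pascal-∸ a≤M b<N) ⟩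
    c a (suc b) * ι (P ℕ.+ Q)                            ≡⟨ cong (c a (suc b) *_) (ι-+ P Q) ⟩
    c a (suc b) * (ι P + ι Q)                            ≡⟨ *-distribˡ-+ (c a (suc b)) (ι P) (ι Q) ⟩
    f (suc b) + g (suc b)                                ∎
    where
    P = paths (M ∸ a) (suc N ∸ suc b)
    Q = paths (suc M ∸ a) (N ∸ suc b)
  swap : ∀ x y z → x + y + z ≡ x + z + y
  swap = solve-∀ ℚ-ring

row-self : ∀ c M N → row c M N M ≡ Σ₁ N (c M)
row-self c M N = Σ₁-cong N λ b _ →
  trans (cong (λ d → c M (suc b) * ι (paths d (N ∸ suc b))) (ℕₚ.n∸n≡0 M)) (*-identityʳ (c M (suc b)))

conv-suc-suc : ∀ c M N → conv c (suc M) (suc N) ≡ conv c M (suc N) + conv c (suc M) N + c (suc M) (suc N)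
conv-suc-suc c M N = begin
  Σ₁ M (row c (suc M) (suc N)) + row c (suc M) (suc N) (suc M)
    ≡⟨ cong₂ _+_ (Σ₁-cong M (λ a a<M → row-suc-suc c {N = N} a<M)) (row-self c (suc M) (suc N)) ⟩
  Σ₁ M (λ a → row c M (suc N) a + row c (suc M) N a) + (Σ₁ N (c (suc M)) + c (suc M) (suc N))
    ≡⟨ cong₂ _+_ (Σ₁-+ M (row c M (suc N)) (row c (suc M) N))
                 (cong (_+ c (suc M) (suc N)) (sym (row-self c (suc M) N))) ⟩
  conv c M (suc N) + Σ₁ M (row c (suc M) N) + (row c (suc M) N (suc M) + c (suc M) (suc N))
    ≡⟨ reassoc (conv c M (suc N)) (Σ₁ M (row c (suc M) N)) (row c (suc M) N (suc M)) (c (suc M) (suc N)) ⟩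
  conv c M (suc N) + conv c (suc M) N + c (suc M) (suc N)
    ∎
  where
  reassoc : ∀ w x y z → w + x + (y + z) ≡ w + (x + y) + z
  reassoc = solve-∀ ℚ-ring

firstRow : (ℕ → ℚ) → ℕ → ℕ → ℚ
firstRow d (suc zero) b = d b
firstRow d _          _ = 0ℚ

conv-firstRow : ∀ d u N → conv (firstRow d) (suc u) N ≡ Σ₁ N (λ b → d b * ι (paths u (N ∸ b)))
conv-firstRow d u N = Σ₁-first u (row (firstRow d) (suc u) N) λ a →
  trans (Σ₁-cong N (λ b _ → *-zeroˡ (ι (paths (u ∸ suc a) (N ∸ suc b))))) (Σ₁-0 N)

binomialSum≡conv : ∀ M N (c c′ : ℕ → ℕ → ℚ) → (∀ i j → suc i ≤ M → suc j ≤ N → c (suc i) (suc j) ≡ c′ (suc i) (suc j)) →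
  Σ₁ M (λ a → Σ₁ N (λ b → c a b * ι ((M ℕ.+ N ∸ a ∸ b) C (M ∸ a)))) ≡ conv c′ M N
binomialSum≡conv M N c c′ c≗c′ = Σ₁-cong M λ i i<M → Σ₁-cong N λ j j<N →
  cong₂ _*_ (c≗c′ i j i<M j<N) (cong ι (C≡paths-∸ i<M j<N))

shift : (ℕ → ℕ → ℚ) → ℕ → ℕ → ℚ
shift t a b = t (a ∸ 1) (b ∸ 1)

boundary : (ℕ → ℕ → ℚ) → ℕ → ℚ
boundary t b = ι b * (t 0 (b ∸ 1) - t 0 b)

module _ (t : ℕ → ℕ → ℚ) {m n : ℕ}
         (pascal : ∀ i j → suc i ≤ m → suc j ≤ n → t (suc i) (suc j) ≡ t i (suc j) + t (suc i) j) where

  conv-pascal : ∀ v N → suc v ≤ m → N ≤ n →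
    conv (shift t) (suc v) N ≡ ι N * t v N + conv (firstRow (boundary t)) (suc v) N
  conv-pascal v zero _ _ = begin
    conv (shift t) (suc v) 0                                ≡⟨ conv-zeroʳ (shift t) (suc v) ⟩
    0ℚ                                                      ≡⟨ cong₂ _+_ (*-zeroˡ (t v 0)) (conv-zeroʳ (firstRow (boundary t)) (suc v)) ⟨
    ι 0 * t v 0 + conv (firstRow (boundary t)) (suc v) 0    ∎
  conv-pascal zero (suc N) 1≤m N<n = begin
    conv (shift t) 1 (suc N)
      ≡⟨ conv-suc-suc (shift t) 0 N ⟩
    0ℚ + conv (shift t) 1 N + t 0 N
      ≡⟨ cong (λ z → 0ℚ + z + t 0 N) (conv-pascal zero N 1≤m (ℕₚ.<⇒≤ N<n)) ⟩
    0ℚ + (ι N * t 0 N + E) + t 0 N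
      ≡⟨ first-row-step (ι N) (t 0 N) (t 0 (suc N)) E ⟩
    (1ℚ + ι N) * t 0 (suc N) + (0ℚ + E + (1ℚ + ι N) * (t 0 N - t 0 (suc N)))
      ≡⟨ cong (λ k → k * t 0 (suc N) + (0ℚ + E + k * (t 0 N - t 0 (suc N)))) (ι-suc N) ⟨
    ι (suc N) * t 0 (suc N) + (0ℚ + E + boundary t (suc N))
      ≡⟨ cong (ι (suc N) * t 0 (suc N) +_) (conv-suc-suc (firstRow (boundary t)) 0 N) ⟨
    ι (suc N) * t 0 (suc N) + conv (firstRow (boundary t)) 1 (suc N)
      ∎
    where
    E = conv (firstRow (boundary t)) 1 N
    first-row-step : ∀ k a b e → 0ℚ + (k * a + e) + a ≡ (1ℚ + k) * b + (0ℚ + e + (1ℚ + k) * (a - b))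
    first-row-step = solve-∀ ℚ-ring
  conv-pascal (suc v) (suc N) v+1<m N<n = begin
    conv (shift t) (suc (suc v)) (suc N)
      ≡⟨ conv-suc-suc (shift t) (suc v) N ⟩
    conv (shift t) (suc v) (suc N) + conv (shift t) (suc (suc v)) N + t (suc v) N
      ≡⟨ cong₂ (λ y z → y + z + t (suc v) N) (conv-pascal v (suc N) (ℕₚ.<⇒≤ v+1<m) N<n)
                                              (conv-pascal (suc v) N v+1<m (ℕₚ.<⇒≤ N<n)) ⟩
    ι (suc N) * a + E₁ + (ι N * b + E₂) + b
      ≡⟨ cong (λ k → k * a + E₁ + (ι N * b + E₂) + b) (ι-suc N) ⟩
    (1ℚ + ι N) * a + E₁ + (ι N * b + E₂) + b
      ≡⟨ interior-step (ι N) a b E₁ E₂ ⟩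
    (1ℚ + ι N) * (a + b) + (E₁ + E₂ + 0ℚ)
      ≡⟨ cong₂ (λ k l → k * l + (E₁ + E₂ + 0ℚ)) (ι-suc N) (pascal v N (ℕₚ.<⇒≤ v+1<m) N<n) ⟨
    ι (suc N) * t (suc v) (suc N) + (E₁ + E₂ + 0ℚ)
      ≡⟨ cong (ι (suc N) * t (suc v) (suc N) +_) (conv-suc-suc (firstRow (boundary t)) (suc v) N) ⟨
    ι (suc N) * t (suc v) (suc N) + conv (firstRow (boundary t)) (suc (suc v)) (suc N)
      ∎
    where
    a = t v (suc N)
    b = t (suc v) N
    E₁ = conv (firstRow (boundary t)) (suc v) (suc N)
    E₂ = conv (firstRow (boundary t)) (suc (suc v)) N
    interior-step : ∀ k a b e₁ e₂ → (1ℚ + k) * a + e₁ + (k * b + e₂) + b ≡ (1ℚ + k) * (a + b) + (e₁ + e₂ + 0ℚ)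
    interior-step = solve-∀ ℚ-ring

pochRatio : ℚ → ℚ → ℚ → ℕ → ℕ → ℚ
pochRatio p q r i j = poch r (i ℕ.+ j) /ₜ (poch p i * poch q j)

pochRatio-cleared : ∀ p q r i j → poch p i ≢ 0ℚ → poch q j ≢ 0ℚ →
  pochRatio p q r i j * (poch p i * poch q j) ≡ poch r (i ℕ.+ j)
pochRatio-cleared p q r i j pᵢ≢0 qⱼ≢0 = p/q*q≡p (poch r (i ℕ.+ j)) (p*q≢0 pᵢ≢0 qⱼ≢0)

pochRatio-pascal : ∀ p q r → r + 1ℚ ≡ p + q → ∀ i j → poch p (suc i) ≢ 0ℚ → poch q (suc j) ≢ 0ℚ →
  pochRatio p q r (suc i) (suc j) ≡ pochRatio p q r i (suc j) + pochRatio p q r (suc i) j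
pochRatio-pascal p q r r+1≡p+q i j pᵢ₊₁≢0 qⱼ₊₁≢0 = *-cancelʳ-≡ (p*q≢0 pᵢ₊₁≢0 qⱼ₊₁≢0) (begin
  τ (suc i) (suc j) * (poch p (suc i) * poch q (suc j))
    ≡⟨ pochRatio-cleared p q r (suc i) (suc j) pᵢ₊₁≢0 qⱼ₊₁≢0 ⟩
  poch r (suc (i ℕ.+ suc j))
    ≡⟨ cong (λ k → poch r (suc k)) (ℕₚ.+-suc i j) ⟩
  R * (r + ι (suc (i ℕ.+ j)))
    ≡⟨ cong (λ k → R * (r + k)) (trans (ι-suc (i ℕ.+ j)) (cong (1ℚ +_) (ι-+ i j))) ⟩
  R * (r + (1ℚ + (ι i + ι j)))
    ≡⟨ cong (R *_) (trans (split-one r (ι i) (ι j)) (cong (λ s → s + (ι i + ι j)) r+1≡p+q)) ⟩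
  R * (p + q + (ι i + ι j))
    ≡⟨ trans (cong (R *_) (regroup p q (ι i) (ι j))) (*-distribˡ-+ R (p + ι i) (q + ι j)) ⟩
  R * (p + ι i) + R * (q + ι j)
    ≡⟨ cong₂ (λ y z → y * (p + ι i) + z * (q + ι j))
         (trans (pochRatio-cleared p q r i (suc j) pᵢ≢0 qⱼ₊₁≢0) (cong (poch r) (ℕₚ.+-suc i j)))
         (pochRatio-cleared p q r (suc i) j pᵢ₊₁≢0 qⱼ≢0) ⟨
  τ i (suc j) * (poch p i * poch q (suc j)) * (p + ι i) + τ (suc i) j * (poch p (suc i) * poch q j) * (q + ι j)
    ≡⟨ common-denominator (τ i (suc j)) (τ (suc i) j) (poch p i) (p + ι i) (poch q j) (q + ι j) ⟩
  (τ i (suc j) + τ (suc i) j) * (poch p (suc i) * poch q (suc j))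
    ∎)
  where
  τ = pochRatio p q r
  R = poch r (suc (i ℕ.+ j))
  pᵢ≢0 : poch p i ≢ 0ℚ
  pᵢ≢0 = p*q≢0⇒p≢0 pᵢ₊₁≢0
  qⱼ≢0 : poch q j ≢ 0ℚ
  qⱼ≢0 = p*q≢0⇒p≢0 qⱼ₊₁≢0
  split-one : ∀ r a b → r + (1ℚ + (a + b)) ≡ r + 1ℚ + (a + b)
  split-one = solve-∀ ℚ-ring
  regroup : ∀ p q a b → p + q + (a + b) ≡ p + a + (q + b)
  regroup = solve-∀ ℚ-ring
  common-denominator : ∀ A B P p Q q → A * (P * (Q * q)) * p + B * (P * p * Q) * q ≡ (A + B) * (P * p * (Q * q))
  common-denominator = solve-∀ ℚ-ring

leading-identity : ∀ M U N x T P Q → M ≡ 1ℚ + U →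
  M * N * (T * (P * Q) * (M * x + N * x + 1ℚ + (U + N))) ≡ N * T * ((M + N) * (P * (M * x + 1ℚ + U)) * Q)
leading-identity _ U N x T P Q refl = solve (U ∷ N ∷ x ∷ T ∷ P ∷ Q ∷ []) ℚ-ring

telescope-identity : ∀ M N K E x R V B → N ≡ 1ℚ + (K + E) → M * V ≡ E * B →
  (1ℚ + K) * (R * (N * x + 1ℚ + K) - R * (M * x + N * x + 1ℚ + K)) * B * (1ℚ + x)
    ≡ (R * (M * x + N * x + 1ℚ + K) * V - R * (N * x + 1ℚ + K) * (V + B)) * (M * x)
telescope-identity M _ K E x R V B refl MV≡EB = begin
  (1ℚ + K) * (R * ((1ℚ + (K + E)) * x + 1ℚ + K) - R * (M * x + (1ℚ + (K + E)) * x + 1ℚ + K)) * B * (1ℚ + x)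
    ≡⟨ solve (M ∷ K ∷ E ∷ x ∷ R ∷ B ∷ []) ℚ-ring ⟩
  R * (M * x) * (x * (E * B) - ((1ℚ + (K + E)) * x + 1ℚ + K) * B)
    ≡⟨ cong (λ z → R * (M * x) * (x * z - ((1ℚ + (K + E)) * x + 1ℚ + K) * B)) MV≡EB ⟨
  R * (M * x) * (x * (M * V) - ((1ℚ + (K + E)) * x + 1ℚ + K) * B)
    ≡⟨ solve (M ∷ K ∷ E ∷ x ∷ R ∷ V ∷ B ∷ []) ℚ-ring ⟩
  (R * (M * x + (1ℚ + (K + E)) * x + 1ℚ + K) * V - R * ((1ℚ + (K + E)) * x + 1ℚ + K) * (V + B)) * (M * x)
    ∎

module NonDegenerate (u n′ : ℕ) (x : ℚ)
  (pₘ≢0 : poch (ι (suc u) * x + 1ℚ) (suc u) ≢ 0ℚ)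
  (qₙ≢0 : poch (ι (suc n′) * x + 1ℚ) (suc n′) ≢ 0ℚ) where

  m n : ℕ
  m = suc u
  n = suc n′

  p q r : ℚ
  p = ι m * x + 1ℚ
  q = ι n * x + 1ℚ
  r = ι m * x + ι n * x + 1ℚ

  t : ℕ → ℕ → ℚ
  t = pochRatio p q r

  summand : ℕ → ℕ → ℚ
  summand a b = poch r (a ℕ.+ b ∸ 2) /ₜ (poch p (a ∸ 1) * poch q (b ∸ 1))

  summand≡shift : ∀ i j → suc i ≤ m → suc j ≤ n → summand (suc i) (suc j) ≡ shift t (suc i) (suc j)
  summand≡shift i j _ _ = cong (λ k → poch r (k ∸ 1) /ₜ (poch p i * poch q j)) (ℕₚ.+-suc i j)

  pᵢ≢0 : ∀ {i} → i ≤ m → poch p i ≢ 0ℚ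
  pᵢ≢0 i≤m = poch-≢0-≤ p m i≤m pₘ≢0

  qⱼ≢0 : ∀ {j} → j ≤ n → poch q j ≢ 0ℚ
  qⱼ≢0 j≤n = poch-≢0-≤ q n j≤n qₙ≢0

  t-pascal : ∀ i j → suc i ≤ m → suc j ≤ n → t (suc i) (suc j) ≡ t i (suc j) + t (suc i) j
  t-pascal i j i<m j<n = pochRatio-pascal p q r (r+1≡p+q (ι m * x) (ι n * x)) i j (pᵢ≢0 i<m) (qⱼ≢0 j<n)
    where
    r+1≡p+q : ∀ a b → a + b + 1ℚ + 1ℚ ≡ a + 1ℚ + (b + 1ℚ)
    r+1≡p+q = solve-∀ ℚ-ring

  leading-term : ι (m ℕ.+ n) ≢ 0ℚ →
    ι n * t u n ≡ (ι m * ι n * poch r (m ℕ.+ n)) /ₜ (ι (m ℕ.+ n) * poch p m * poch q n)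
  leading-term m+n≢0 = sym (p≡z*q⇒p/q≡z (p*q≢0 (p*q≢0 m+n≢0 pₘ≢0) qₙ≢0) (begin
    ι m * ι n * (poch r (u ℕ.+ n) * (r + ι (u ℕ.+ n)))
      ≡⟨ cong₂ (λ y z → ι m * ι n * (y * (r + z)))
               (pochRatio-cleared p q r u n (pᵢ≢0 (ℕₚ.n≤1+n u)) qₙ≢0) (sym (ι-+ u n)) ⟨
    ι m * ι n * (t u n * (poch p u * poch q n) * (r + (ι u + ι n)))
      ≡⟨ leading-identity (ι m) (ι u) (ι n) x (t u n) (poch p u) (poch q n) (ι-suc u) ⟩
    ι n * t u n * ((ι m + ι n) * poch p m * poch q n)
      ≡⟨ cong (λ z → ι n * t u n * (z * poch p m * poch q n)) (ι-+ m n) ⟨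
    ι n * t u n * (ι (m ℕ.+ n) * poch p m * poch q n)
      ∎))

  -- V e = C(m + e - 1, m), which vanishes at e = 0
  V : ℕ → ℚ
  V zero    = 0ℚ
  V (suc e) = ι (paths m e)

  V-suc : ∀ e → V (suc e) ≡ V e + ι (paths u e)
  V-suc zero    = sym (trans (+-identityˡ (ι (paths u 0))) (cong ι (paths-zeroʳ u)))
  V-suc (suc e) = trans (ι-+ (paths u (suc e)) (paths m e)) (+-comm (ι (paths u (suc e))) (ι (paths m e)))

  V-absorb : ∀ e → ι m * V e ≡ ι e * ι (paths u e)
  V-absorb zero    = trans (*-zeroʳ (ι m)) (sym (*-zeroˡ (ι (paths u 0))))
  V-absorb (suc e) = begin
    ι m * ι (paths m e)                  ≡⟨ ι-* m (paths m e) ⟨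
    ι (m ℕ.* paths m e)                  ≡⟨ cong ι (trans (paths-absorbˡ u e) (sym (paths-absorbʳ u e))) ⟩
    ι (suc e ℕ.* paths u (suc e))        ≡⟨ ι-* (suc e) (paths u (suc e)) ⟩
    ι (suc e) * ι (paths u (suc e))      ∎

  W : ℕ → ℚ
  W k = t 0 k * V (n ∸ k)

  R : ℕ → ℚ
  R k = poch r k /ₜ poch q (suc k)

  t₀-factor : ∀ k → suc k ≤ n → t 0 k ≡ R k * (q + ι k)
  t₀-factor k k<n = p≡z*q⇒p/q≡z (p*q≢0 (pᵢ≢0 ℕ.z≤n) (qⱼ≢0 (ℕₚ.<⇒≤ k<n)))
    (trans (sym (p/q*q≡p (poch r k) (qⱼ≢0 k<n))) (rearrange (R k) (poch q k) (q + ι k)))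
    where
    rearrange : ∀ a b c → a * (b * c) ≡ a * c * (1ℚ * b)
    rearrange = solve-∀ ℚ-ring

  t₀-factor-suc : ∀ k → suc k ≤ n → t 0 (suc k) ≡ R k * (r + ι k)
  t₀-factor-suc k k<n = p≡z*q⇒p/q≡z (p*q≢0 (pᵢ≢0 ℕ.z≤n) (qⱼ≢0 k<n))
    (trans (cong (_* (r + ι k)) (sym (p/q*q≡p (poch r k) (qⱼ≢0 k<n)))) (rearrange (R k) (poch q (suc k)) (r + ι k)))
    where
    rearrange : ∀ a b c → a * b * c ≡ a * c * (1ℚ * b)
    rearrange = solve-∀ ℚ-ring

  telescope-step : ∀ k → suc k ≤ n →
    boundary t (suc k) * ι (paths u (n ∸ suc k)) * (1ℚ + x) ≡ (W (suc k) - W k) * (ι m * x)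
  telescope-step k k<n = begin
    ι (suc k) * (t 0 k - t 0 (suc k)) * B * (1ℚ + x)
      ≡⟨ cong₂ (λ c d → ι (suc k) * (c - d) * B * (1ℚ + x)) (t₀-factor k k<n) (t₀-factor-suc k k<n) ⟩
    ι (suc k) * (R k * (q + ι k) - R k * (r + ι k)) * B * (1ℚ + x)
      ≡⟨ cong (λ a → a * (R k * (q + ι k) - R k * (r + ι k)) * B * (1ℚ + x)) (ι-suc k) ⟩
    (1ℚ + ι k) * (R k * (q + ι k) - R k * (r + ι k)) * B * (1ℚ + x)
      ≡⟨ telescope-identity (ι m) (ι n) (ι k) (ι e) x (R k) (V e) B ι-n (V-absorb e) ⟩
    (R k * (r + ι k) * V e - R k * (q + ι k) * (V e + B)) * (ι m * x)
      ≡⟨ cong₂ (λ a c → (a * V e - c) * (ι m * x))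
               (t₀-factor-suc k k<n) (cong₂ _*_ (t₀-factor k k<n) (trans (cong V n∸k≡1+e) (V-suc e))) ⟨
    (t 0 (suc k) * V e - t 0 k * V (n ∸ k)) * (ι m * x)
      ∎
    where
    k≤n′ = ℕₚ.≤-pred k<n
    e = n′ ∸ k
    B = ι (paths u e)
    n∸k≡1+e : n ∸ k ≡ suc e
    n∸k≡1+e = ℕₚ.+-∸-assoc 1 k≤n′
    ι-n : ι n ≡ 1ℚ + (ι k + ι e)
    ι-n = trans (ι-suc n′) (cong (1ℚ +_) (trans (cong ι (sym (ℕₚ.m+[n∸m]≡n k≤n′))) (ι-+ k e)))

  correction : ℚ
  correction = (ι m * ι n * x) /ₜ (ι (m ℕ.+ n) * (1ℚ + x)) * ι ((m ℕ.+ n) C m)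

  n*C≡[m+n]*paths : n ℕ.* ((m ℕ.+ n) C m) ≡ (m ℕ.+ n) ℕ.* paths m n′
  n*C≡[m+n]*paths = begin
    n ℕ.* ((m ℕ.+ n) C m)           ≡⟨ cong (n ℕ.*_) (C≡paths m n) ⟩
    n ℕ.* paths m n                 ≡⟨ paths-absorbʳ m n′ ⟩
    suc (m ℕ.+ n′) ℕ.* paths m n′   ≡⟨ cong (ℕ._* paths m n′) (ℕₚ.+-suc m n′) ⟨
    (m ℕ.+ n) ℕ.* paths m n′        ∎

  correction-cleared : 1ℚ + x ≢ 0ℚ → ι (m ℕ.+ n) ≢ 0ℚ → correction * (1ℚ + x) ≡ ι m * x * ι (paths m n′)
  correction-cleared 1+x≢0 m+n≢0 = *-cancelʳ-≡ m+n≢0 (begin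
    β * ι binom * (1ℚ + x) * ι (m ℕ.+ n)      ≡⟨ regroup₁ β (ι binom) (1ℚ + x) (ι (m ℕ.+ n)) ⟩
    β * (ι (m ℕ.+ n) * (1ℚ + x)) * ι binom    ≡⟨ cong (_* ι binom) (p/q*q≡p (ι m * ι n * x) (p*q≢0 m+n≢0 1+x≢0)) ⟩
    ι m * ι n * x * ι binom                   ≡⟨ regroup₂ (ι m) (ι n) x (ι binom) ⟩
    ι m * x * (ι n * ι binom)                 ≡⟨ cong (ι m * x *_) (ι-* n binom) ⟨
    ι m * x * ι (n ℕ.* binom)                 ≡⟨ cong (λ k → ι m * x * ι k) n*C≡[m+n]*paths ⟩
    ι m * x * ι ((m ℕ.+ n) ℕ.* paths m n′)    ≡⟨ cong (ι m * x *_) (ι-* (m ℕ.+ n) (paths m n′)) ⟩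
    ι m * x * (ι (m ℕ.+ n) * ι (paths m n′))  ≡⟨ regroup₃ (ι m * x) (ι (m ℕ.+ n)) (ι (paths m n′)) ⟩
    ι m * x * ι (paths m n′) * ι (m ℕ.+ n)    ∎)
    where
    β = (ι m * ι n * x) /ₜ (ι (m ℕ.+ n) * (1ℚ + x))
    binom = (m ℕ.+ n) C m
    regroup₁ : ∀ a b c d → a * b * c * d ≡ a * (d * c) * b
    regroup₁ = solve-∀ ℚ-ring
    regroup₂ : ∀ a b c d → a * b * c * d ≡ a * c * (b * d)
    regroup₂ = solve-∀ ℚ-ring
    regroup₃ : ∀ a b c → a * (b * c) ≡ a * c * b
    regroup₃ = solve-∀ ℚ-ring

  boundary-sum : 1ℚ + x ≢ 0ℚ → ι (m ℕ.+ n) ≢ 0ℚ → conv (firstRow (boundary t)) m n ≡ - correction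
  boundary-sum 1+x≢0 m+n≢0 = *-cancelʳ-≡ 1+x≢0 (begin
    conv (firstRow (boundary t)) m n * (1ℚ + x)      ≡⟨ cong (_* (1ℚ + x)) (conv-firstRow (boundary t) u n) ⟩
    Σ₁ n f * (1ℚ + x)                                ≡⟨ Σ₁-*ʳ n f (1ℚ + x) ⟩
    Σ₁ n (λ b → f b * (1ℚ + x))                      ≡⟨ Σ₁-cong n telescope-step ⟩
    Σ₁ n (λ b → (W b - W (b ∸ 1)) * (ι m * x))       ≡⟨ Σ₁-*ʳ n (λ b → W b - W (b ∸ 1)) (ι m * x) ⟨
    Σ₁ n (λ b → W b - W (b ∸ 1)) * (ι m * x)         ≡⟨ cong (_* (ι m * x)) (Σ₁-telescope n W) ⟩
    (t 0 n * V (n ∸ n) - W 0) * (ι m * x)            ≡⟨ cong (λ k → (t 0 n * V k - W 0) * (ι m * x)) (ℕₚ.n∸n≡0 n) ⟩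
    (t 0 n * 0ℚ - 1ℚ * ι (paths m n′)) * (ι m * x)   ≡⟨ telescope-ends (t 0 n) (ι (paths m n′)) (ι m * x) ⟩
    - (ι m * x * ι (paths m n′))                     ≡⟨ cong -_ (correction-cleared 1+x≢0 m+n≢0) ⟨
    - (correction * (1ℚ + x))                        ≡⟨ neg-distribˡ-* correction (1ℚ + x) ⟩
    - correction * (1ℚ + x)                          ∎)
    where
    f : ℕ → ℚ
    f b = boundary t b * ι (paths u (n ∸ b))
    telescope-ends : ∀ a b c → (a * 0ℚ - 1ℚ * b) * c ≡ - (c * b)
    telescope-ends = solve-∀ ℚ-ring

rhs-vanishes : ∀ m n x → ι m * ι n ≡ 0ℚ →
  0ℚ ≡ (ι m * ι n * poch (ι m * x + ι n * x + 1ℚ) (m ℕ.+ n))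
         /ₜ (ι (m ℕ.+ n) * poch (ι m * x + 1ℚ) m * poch (ι n * x + 1ℚ) n)
       - ((ι m * ι n * x) /ₜ (ι (m ℕ.+ n) * (1ℚ + x))) * ι ((m ℕ.+ n) C m)
rhs-vanishes m n x mn≡0 = sym (begin
  (ι m * ι n * P) /ₜ Y - (ι m * ι n * x) /ₜ Y′ * B  ≡⟨ cong (λ A → (A * P) /ₜ Y - (A * x) /ₜ Y′ * B) mn≡0 ⟩
  (0ℚ * P) /ₜ Y - (0ℚ * x) /ₜ Y′ * B                ≡⟨ cong₂ (λ a b → a /ₜ Y - b /ₜ Y′ * B) (*-zeroˡ P) (*-zeroˡ x) ⟩
  0ℚ /ₜ Y - 0ℚ /ₜ Y′ * B                            ≡⟨ cong₂ (λ a b → a - b * B) (0/q≡0 Y) (0/q≡0 Y′) ⟩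
  0ℚ - 0ℚ * B                                       ≡⟨ cong (λ b → 0ℚ - b) (*-zeroˡ B) ⟩
  0ℚ                                                ∎)
  where
  P = poch (ι m * x + ι n * x + 1ℚ) (m ℕ.+ n)
  Y = ι (m ℕ.+ n) * poch (ι m * x + 1ℚ) m * poch (ι n * x + 1ℚ) n
  Y′ = ι (m ℕ.+ n) * (1ℚ + x)
  B = ι ((m ℕ.+ n) C m)

mainTheorem4 : (m n : ℕ) (x : ℚ) →
    ι (m ℕ.+ n) ≢ 0ℚ →
    1ℚ + x ≢ 0ℚ →
    poch (ι m * x + 1ℚ) m ≢ 0ℚ →
    poch (ι n * x + 1ℚ) n ≢ 0ℚ →
    Σ₁ m (λ a → Σ₁ n (λ b →
        (poch (ι m * x + ι n * x + 1ℚ) (a ℕ.+ b ℕ.∸ 2)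
          /ₜ (poch (ι m * x + 1ℚ) (a ℕ.∸ 1) * poch (ι n * x + 1ℚ) (b ℕ.∸ 1)))
        * ι ((m ℕ.+ n ℕ.∸ a ℕ.∸ b) C (m ℕ.∸ a))))
    ≡ (ι m * ι n * poch (ι m * x + ι n * x + 1ℚ) (m ℕ.+ n))
        /ₜ (ι (m ℕ.+ n) * poch (ι m * x + 1ℚ) m * poch (ι n * x + 1ℚ) n)
      - ((ι m * ι n * x) /ₜ (ι (m ℕ.+ n) * (1ℚ + x))) * ι ((m ℕ.+ n) C m)
mainTheorem4 zero    n       x _ _ _ _ = rhs-vanishes 0 n x (*-zeroˡ (ι n))
mainTheorem4 (suc u) zero    x _ _ _ _ = trans (Σ₁-0 (suc u)) (rhs-vanishes (suc u) 0 x (*-zeroʳ (ι (suc u))))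
mainTheorem4 (suc u) (suc n′) x m+n≢0 1+x≢0 pₘ≢0 qₙ≢0 =
  trans (binomialSum≡conv m n summand (shift t) summand≡shift) (begin
    conv (shift t) m n                               ≡⟨ conv-pascal t t-pascal u n ℕₚ.≤-refl ℕₚ.≤-refl ⟩
    ι n * t u n + conv (firstRow (boundary t)) m n   ≡⟨ cong₂ _+_ (leading-term m+n≢0) (boundary-sum 1+x≢0 m+n≢0) ⟩
    (ι m * ι n * poch r (m ℕ.+ n)) /ₜ (ι (m ℕ.+ n) * poch p m * poch q n) - correction ∎)
  where open NonDegenerate u n′ x pₘ≢0 qₙ≢0
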